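{- Let $\Gamma$ be a finite nontrivial connected graph, let $G\le\mathrm{Aut}(\Gamma)$ act primitively on the edges of $\Gamma$, and let $e=\{u,v\}$ be an edge. If $G_v$ acts unfaithfully on the set $\Gamma(v)$ of neighbours of $v$, then neither $G_v$ nor $G_e$ is an almost simple group.
   Context: A connected $G$-edge-primitive graph is nontrivial if it is $G$-arc-transitive of valency at least 3. -}

module Defs where

open import Data.Nat using (ℕ)
open import Data.Fin using (Fin)
open import Data.Fin.Permutation using (Permutation′; _⟨$⟩ʳ_; id; flip; _∘ₚ_)
  renaming (_≈_ to _≈ₚ_)
open import Data.Product using (Σ; ∃; _×_; _,_)
open import Data.Sum using (_⊎_)
open import Relation.Binary.PropositionalEquality using (_≡_; _≢_)
open import Relation.Nullary using (¬_)

record Graph (n : ℕ) : Set₁ where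
  field
    Adj    : Fin n → Fin n → Set
    sym    : ∀ {u v} → Adj u v → Adj v u
    irrefl : ∀ {v} → ¬ Adj v v
open Graph public

data Walk {n : ℕ} (Γ : Graph n) : Fin n → Fin n → Set where
  [] : ∀ {v} → Walk Γ v v
  _∷_ : ∀ {u w v} → Adj Γ u w → Walk Γ w v → Walk Γ u v

Connected : ∀ {n} → Graph n → Set
Connected Γ = ∀ u v → Walk Γ u v

Perm : ℕ → Set
Perm n = Permutation′ n

record IsSubgroup {n : ℕ} (H : Perm n → Set) : Set where
  field
    resp  : ∀ {g h} → g ≈ₚ h → H g → H h
    has-id : H id
    ∘-closed : ∀ {g h} → H g → H h → H (g ∘ₚ h)
    inv-closed : ∀ {g} → H g → H (flip g)

_⊆_ : ∀ {n} → (Perm n → Set) → (Perm n → Set) → Set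
A ⊆ B = ∀ g → A g → B g

Normal : ∀ {n} → (Perm n → Set) → (Perm n → Set) → Set
Normal N H = ∀ h x → H h → N x → N ((flip h ∘ₚ x) ∘ₚ h)

IsAut : ∀ {n} → Graph n → Perm n → Set
IsAut Γ g = ∀ u v → (Adj Γ u v → Adj Γ (g ⟨$⟩ʳ u) (g ⟨$⟩ʳ v))
                  × (Adj Γ (g ⟨$⟩ʳ u) (g ⟨$⟩ʳ v) → Adj Γ u v)

-- Edges: an edge {u,v} is represented by an ordered pair (u,v) with
-- Adj u v; two such pairs represent the same edge iff they agree up to
-- swapping.

SameEdge : ∀ {n} → Fin n → Fin n → Fin n → Fin n → Set
SameEdge u v x y = (u ≡ x × v ≡ y) ⊎ (u ≡ y × v ≡ x)

EdgeTransitive : ∀ {n} → Graph n → (Perm n → Set) → Set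
EdgeTransitive Γ G = ∀ u v x y → Adj Γ u v → Adj Γ x y →
  ∃ λ g → G g × SameEdge (g ⟨$⟩ʳ u) (g ⟨$⟩ʳ v) x y

record IsEdgeCongruence {n} (Γ : Graph n) (G : Perm n → Set)
         (R : Fin n → Fin n → Fin n → Fin n → Set) : Set where
  field
    well-def : ∀ {u v u' v' x y} → Adj Γ u v → Adj Γ x y →
               SameEdge u v u' v' → R u v x y → R u' v' x y
    refl′  : ∀ {u v} → Adj Γ u v → R u v u v
    sym′   : ∀ {u v x y} → Adj Γ u v → Adj Γ x y → R u v x y → R x y u v
    trans′ : ∀ {u v x y a b} → Adj Γ u v → Adj Γ x y → Adj Γ a b →
             R u v x y → R x y a b → R u v a b
    invariant : ∀ {g u v x y} → G g → Adj Γ u v → Adj Γ x y → R u v x y →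
                R (g ⟨$⟩ʳ u) (g ⟨$⟩ʳ v) (g ⟨$⟩ʳ x) (g ⟨$⟩ʳ y)

-- G acts primitively on E(Γ): transitively, and every G-invariant
-- partition (equivalently G-invariant equivalence relation) of E(Γ)
-- is trivial (equality or universal).
EdgePrimitive : ∀ {n} → Graph n → (Perm n → Set) → Set₁
EdgePrimitive Γ G =
  EdgeTransitive Γ G ×
  (∀ R → IsEdgeCongruence Γ G R →
     (∀ u v x y → Adj Γ u v → Adj Γ x y → R u v x y → SameEdge u v x y)
   ⊎ (∀ u v x y → Adj Γ u v → Adj Γ x y → R u v x y))

ArcTransitive : ∀ {n} → Graph n → (Perm n → Set) → Set
ArcTransitive Γ G = ∀ u v x y → Adj Γ u v → Adj Γ x y →
  ∃ λ g → G g × (g ⟨$⟩ʳ u ≡ x) × (g ⟨$⟩ʳ v ≡ y)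

ValencyAtLeast3 : ∀ {n} → Graph n → Set
ValencyAtLeast3 Γ = ∀ v → ∃ λ a → ∃ λ b → ∃ λ c →
  Adj Γ v a × Adj Γ v b × Adj Γ v c × a ≢ b × a ≢ c × b ≢ c

Nontrivial : ∀ {n} → Graph n → (Perm n → Set) → Set
Nontrivial Γ G = ArcTransitive Γ G × ValencyAtLeast3 Γ

Stab : ∀ {n} → (Perm n → Set) → Fin n → Perm n → Set
Stab G v g = G g × g ⟨$⟩ʳ v ≡ v

EdgeStab : ∀ {n} → (Perm n → Set) → Fin n → Fin n → Perm n → Set
EdgeStab G u v g = G g × SameEdge (g ⟨$⟩ʳ u) (g ⟨$⟩ʳ v) u v

UnfaithfulOnNbhd : ∀ {n} → Graph n → (Perm n → Set) → Fin n → Set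
UnfaithfulOnNbhd Γ G v = ∃ λ g → Stab G v g ×
  (∀ w → Adj Γ v w → g ⟨$⟩ʳ w ≡ w) × ¬ (g ≈ₚ id)

NonabelianSimple : ∀ {n} → (Perm n → Set) → Set₁
NonabelianSimple T =
  (∃ λ x → ∃ λ y → T x × T y × ¬ ((x ∘ₚ y) ≈ₚ (y ∘ₚ x))) ×
  (∀ N → IsSubgroup N → N ⊆ T → Normal N T →
     (∀ x → N x → x ≈ₚ id) ⊎ (T ⊆ N))

-- H is almost simple: H has a nonabelian simple normal subgroup T such
-- that the conjugation action H → Aut(T) is faithful, i.e. C_H(T) = 1
-- (so that T ⊴ H ≤ Aut(T)).
AlmostSimple : ∀ {n} → (Perm n → Set) → Set₁
AlmostSimple H = Σ (Perm _ → Set) λ T →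
  IsSubgroup T × T ⊆ H × Normal T H × NonabelianSimple T ×
  (∀ h → H h → (∀ t → T t → (h ∘ₚ t) ≈ₚ (t ∘ₚ h)) → h ≈ₚ id)

{-# OPTIONS --safe #-}
-- Let T ⊴ H (H = G_v or G_e) be nonabelian simple with C_H(T) = 1, and let
-- 1 ≠ k ∈ K = G_v^[1].  As T is simple and normalises K, T ∩ K is 1 or T; if it
-- were 1, the commutators [k, t] ∈ T ∩ K would vanish and k would centralise T.
-- So T ≤ K (for H = G_e, T first fixes u and v, having no subgroup of index 2,
-- and the same argument gives T ≤ G_u^[1] as well).  If g ∈ G maps an arc
-- (v, y) to (u, v), then T^g and T^(g⁻¹) lie in H, and the commutator argument
-- applied to T ∩ T^g gives T^g ≤ T.  Along a path from v, every vertex w is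
-- thus mapped to v by some g with T^g ≤ T, so T fixes w; hence T = 1.
module Submission where

open import Defs
open import Data.Fin using (Fin)
open import Data.Fin.Permutation
  using (_⟨$⟩ʳ_; _⟨$⟩ˡ_; id; flip; _∘ₚ_; inverseˡ; inverseʳ)
  renaming (_≈_ to _≈ₚ_)
open import Data.Product using (_×_; _,_; proj₁; proj₂; ∃)
open import Data.Sum using (inj₁; inj₂)
open import Data.Empty using (⊥-elim)
open import Function.Base using (_∘_)
open import Function.Bundles using (Inverse)
open import Relation.Binary.PropositionalEquality as ≡
  using (_≡_; refl; trans; cong; subst)
open import Relation.Nullary using (¬_)

open IsSubgroup using (resp; has-id; ∘-closed; inv-closed)

-- With the diagrammatic _∘ₚ_ of the library, conj g x sends i to g (x (g⁻¹ i)),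
-- so Normal N H says exactly that N is closed under conj h for h ∈ H.
conj : ∀ {n} → Perm n → Perm n → Perm n
conj g x = (flip g ∘ₚ x) ∘ₚ g

-- z t z⁻¹ t⁻¹ in functional notation.
⁅_,_⁆ : ∀ {n} → Perm n → Perm n → Perm n
⁅ z , t ⁆ = flip t ∘ₚ conj z t

Fixes : ∀ {n} → Fin n → Perm n → Set
Fixes a x = x ⟨$⟩ʳ a ≡ a

⟨$⟩ʳ⇒⟨$⟩ˡ : ∀ {n} (g : Perm n) {a b} → g ⟨$⟩ʳ a ≡ b → g ⟨$⟩ˡ b ≡ a
⟨$⟩ʳ⇒⟨$⟩ˡ g ga≡b = Inverse.inverseʳ g (≡.sym ga≡b)

conj-fixes : ∀ {n} (g x : Perm n) {a b} → g ⟨$⟩ʳ a ≡ b → Fixes a x → Fixes b (conj g x)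
conj-fixes g x {a} {b} ga≡b xa≡a = begin
  g ⟨$⟩ʳ (x ⟨$⟩ʳ (g ⟨$⟩ˡ b))  ≡⟨ cong (λ j → g ⟨$⟩ʳ (x ⟨$⟩ʳ j)) (⟨$⟩ʳ⇒⟨$⟩ˡ g ga≡b) ⟩
  g ⟨$⟩ʳ (x ⟨$⟩ʳ a)           ≡⟨ cong (g ⟨$⟩ʳ_) xa≡a ⟩
  g ⟨$⟩ʳ a                    ≡⟨ ga≡b ⟩
  b                           ∎
  where open ≡.≡-Reasoning

conj-fixes⁻¹ : ∀ {n} (g x : Perm n) {a b} →
               g ⟨$⟩ʳ a ≡ b → Fixes b (conj g x) → Fixes a x
conj-fixes⁻¹ g x {a} {b} ga≡b gxg⁻¹-fixes-b = begin
  x ⟨$⟩ʳ a                             ≡⟨ cong (x ⟨$⟩ʳ_) g⁻¹b≡a ⟨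
  x ⟨$⟩ʳ (g ⟨$⟩ˡ b)                    ≡⟨ inverseˡ g ⟨
  g ⟨$⟩ˡ (g ⟨$⟩ʳ (x ⟨$⟩ʳ (g ⟨$⟩ˡ b)))  ≡⟨ cong (g ⟨$⟩ˡ_) gxg⁻¹-fixes-b ⟩
  g ⟨$⟩ˡ b                             ≡⟨ g⁻¹b≡a ⟩
  a                                    ∎
  where
  open ≡.≡-Reasoning
  g⁻¹b≡a : g ⟨$⟩ˡ b ≡ a
  g⁻¹b≡a = ⟨$⟩ʳ⇒⟨$⟩ˡ g ga≡b

conj≈id⇒≈id : ∀ {n} (g x : Perm n) → conj g x ≈ₚ id → x ≈ₚ id
conj≈id⇒≈id g x gxg⁻¹≈id i = conj-fixes⁻¹ g x {b = g ⟨$⟩ʳ i} refl (gxg⁻¹≈id (g ⟨$⟩ʳ i))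

conj-conj : ∀ {n} (g t x : Perm n) → conj (conj g t) (conj g x) ≈ₚ conj g (conj t x)
conj-conj g t x i = begin
  g ⟨$⟩ʳ (t ⟨$⟩ʳ (g ⟨$⟩ˡ (g ⟨$⟩ʳ (x ⟨$⟩ʳ (g ⟨$⟩ˡ (g ⟨$⟩ʳ (t ⟨$⟩ˡ (g ⟨$⟩ˡ i))))))))
    ≡⟨ cong (λ j → g ⟨$⟩ʳ (t ⟨$⟩ʳ (g ⟨$⟩ˡ (g ⟨$⟩ʳ (x ⟨$⟩ʳ j))))) (inverseˡ g) ⟩
  g ⟨$⟩ʳ (t ⟨$⟩ʳ (g ⟨$⟩ˡ (g ⟨$⟩ʳ (x ⟨$⟩ʳ (t ⟨$⟩ˡ (g ⟨$⟩ˡ i))))))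
    ≡⟨ cong (λ j → g ⟨$⟩ʳ (t ⟨$⟩ʳ j)) (inverseˡ g) ⟩
  g ⟨$⟩ʳ (t ⟨$⟩ʳ (x ⟨$⟩ʳ (t ⟨$⟩ˡ (g ⟨$⟩ˡ i))))
    ∎
  where open ≡.≡-Reasoning

≈id⇒commute : ∀ {n} (x y : Perm n) → x ≈ₚ id → (x ∘ₚ y) ≈ₚ (y ∘ₚ x)
≈id⇒commute x y x≈id i = trans (cong (y ⟨$⟩ʳ_) (x≈id i)) (≡.sym (x≈id (y ⟨$⟩ʳ i)))

⁅⁆≈id⇒commute : ∀ {n} (z t : Perm n) → ⁅ z , t ⁆ ≈ₚ id → (z ∘ₚ t) ≈ₚ (t ∘ₚ z)
⁅⁆≈id⇒commute z t ⁅z,t⁆≈id i = begin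
  t ⟨$⟩ʳ (z ⟨$⟩ʳ i)
    ≡⟨ ⁅z,t⁆≈id (t ⟨$⟩ʳ (z ⟨$⟩ʳ i)) ⟨
  z ⟨$⟩ʳ (t ⟨$⟩ʳ (z ⟨$⟩ˡ (t ⟨$⟩ˡ (t ⟨$⟩ʳ (z ⟨$⟩ʳ i)))))
    ≡⟨ cong (λ j → z ⟨$⟩ʳ (t ⟨$⟩ʳ (z ⟨$⟩ˡ j))) (inverseˡ t) ⟩
  z ⟨$⟩ʳ (t ⟨$⟩ʳ (z ⟨$⟩ˡ (z ⟨$⟩ʳ i)))
    ≡⟨ cong (λ j → z ⟨$⟩ʳ (t ⟨$⟩ʳ j)) (inverseˡ z) ⟩
  z ⟨$⟩ʳ (t ⟨$⟩ʳ i)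
    ∎
  where open ≡.≡-Reasoning

conj-closed : ∀ {n} {G : Perm n → Set} → IsSubgroup G → ∀ {g x} → G g → G x → G (conj g x)
conj-closed G≤ Gg Gx = ∘-closed G≤ (∘-closed G≤ (inv-closed G≤ Gg) Gx) Gg

∩-isSubgroup : ∀ {n} {A B : Perm n → Set} → IsSubgroup A → IsSubgroup B →
               IsSubgroup (λ x → A x × B x)
∩-isSubgroup A≤ B≤ = record
  { resp       = λ x≈y (Ax , Bx) → resp A≤ x≈y Ax , resp B≤ x≈y Bx
  ; has-id     = has-id A≤ , has-id B≤
  ; ∘-closed   = λ (Ax , Bx) (Ay , By) → ∘-closed A≤ Ax Ay , ∘-closed B≤ Bx By
  ; inv-closed = λ (Ax , Bx) → inv-closed A≤ Ax , inv-closed B≤ Bx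
  }

⋂-isSubgroup : ∀ {n} {I : Set} (S : I → Set) {H : I → Perm n → Set} →
               (∀ i → IsSubgroup (H i)) → IsSubgroup (λ x → ∀ i → S i → H i x)
⋂-isSubgroup S H≤ = record
  { resp       = λ x≈y Hx i s → resp (H≤ i) x≈y (Hx i s)
  ; has-id     = λ i s → has-id (H≤ i)
  ; ∘-closed   = λ Hx Hy i s → ∘-closed (H≤ i) (Hx i s) (Hy i s)
  ; inv-closed = λ Hx i s → inv-closed (H≤ i) (Hx i s)
  }

fixes-isSubgroup : ∀ {n} (a : Fin n) → IsSubgroup (Fixes a)
fixes-isSubgroup a = record
  { resp       = λ x≈y xa≡a → trans (≡.sym (x≈y a)) xa≡a
  ; has-id     = refl
  ; ∘-closed   = λ {_} {y} xa≡a ya≡a → trans (cong (y ⟨$⟩ʳ_) xa≡a) ya≡a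
  ; inv-closed = λ {x} xa≡a → ⟨$⟩ʳ⇒⟨$⟩ˡ x xa≡a
  }

conjugate-isSubgroup : ∀ {n} {T : Perm n → Set} (g : Perm n) → IsSubgroup T →
                       IsSubgroup (T ∘ conj g)
conjugate-isSubgroup g T≤ = record
  { resp       = λ x≈y → resp T≤ (λ i → cong (g ⟨$⟩ʳ_) (x≈y (g ⟨$⟩ˡ i)))
  ; has-id     = resp T≤ (λ _ → ≡.sym (inverseʳ g)) (has-id T≤)
  ; ∘-closed   = λ {_} {y} Tx Ty →
      resp T≤ (λ _ → cong (λ j → g ⟨$⟩ʳ (y ⟨$⟩ʳ j)) (inverseˡ g)) (∘-closed T≤ Tx Ty)
  ; inv-closed = λ Tx → resp T≤ (λ _ → refl) (inv-closed T≤ Tx)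
  }

nonabelianSimple⇒nontrivial : ∀ {n} {T : Perm n → Set} → NonabelianSimple T →
                              ¬ (∀ x → T x → x ≈ₚ id)
nonabelianSimple⇒nontrivial ((x , y , Tx , _ , xy≉yx) , _) T≡1 =
  xy≉yx (≈id⇒commute x y (T≡1 x Tx))

meet-nontrivial⇒⊆ : ∀ {n} {T K : Perm n → Set} → IsSubgroup T → NonabelianSimple T →
                    IsSubgroup K → Normal K T → ¬ (∀ x → T x → K x → x ≈ₚ id) → T ⊆ K
meet-nontrivial⇒⊆ {T = T} {K} T≤ (_ , simplicity) K≤ K◁T T∩K≢1
  with simplicity (λ x → T x × K x) (∩-isSubgroup T≤ K≤) (λ _ → proj₁)
                  (λ t x Tt (Tx , Kx) → conj-closed T≤ Tt Tx , K◁T t x Tt Kx)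
... | inj₁ T∩K≡1 = ⊥-elim (T∩K≢1 (λ x Tx Kx → T∩K≡1 x (Tx , Kx)))
... | inj₂ T⊆T∩K = λ t Tt → proj₂ (T⊆T∩K t Tt)

stabilises-edge⇒fixes-ends : ∀ {n} {T : Perm n → Set} {u v : Fin n} →
  IsSubgroup T → NonabelianSimple T →
  (∀ t → T t → SameEdge (t ⟨$⟩ʳ u) (t ⟨$⟩ʳ v) u v) → T ⊆ (λ x → Fixes u x × Fixes v x)
stabilises-edge⇒fixes-ends {T = T} {u} {v} T≤ T-simple T-stabilises =
  meet-nontrivial⇒⊆ T≤ T-simple (∩-isSubgroup (fixes-isSubgroup u) (fixes-isSubgroup v))
    ends-fixers-normalised
    (λ T∩Fix≡1 → let (x , y , Tx , Ty , xy≉yx) = proj₁ T-simple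
               in xy≉yx (abelian T∩Fix≡1 Tx Ty))
  where
  ends-fixers-normalised : Normal (λ x → Fixes u x × Fixes v x) T
  ends-fixers-normalised t x Tt (xu≡u , xv≡v) with T-stabilises t Tt
  ... | inj₁ (tu≡u , tv≡v) = conj-fixes t x tu≡u xu≡u , conj-fixes t x tv≡v xv≡v
  ... | inj₂ (tu≡v , tv≡u) = conj-fixes t x tv≡u xv≡v , conj-fixes t x tu≡v xu≡u

  -- The product of two elements of T that swap u and v fixes both.
  abelian : (∀ x → T x → Fixes u x × Fixes v x → x ≈ₚ id) →
            ∀ {x y} → T x → T y → (x ∘ₚ y) ≈ₚ (y ∘ₚ x)
  abelian T∩Fix≡1 {x} {y} Tx Ty with T-stabilises x Tx | T-stabilises y Ty
  ... | inj₁ x-fixes | _ = ≈id⇒commute x y (T∩Fix≡1 x Tx x-fixes)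
  ... | inj₂ _ | inj₁ y-fixes = λ i → ≡.sym (≈id⇒commute y x (T∩Fix≡1 y Ty y-fixes) i)
  ... | inj₂ (xu≡v , xv≡u) | inj₂ (yu≡v , yv≡u) = λ i → trans (xy≈id i) (≡.sym (yx≈id i))
    where
    xy≈id : (x ∘ₚ y) ≈ₚ id
    xy≈id = T∩Fix≡1 (x ∘ₚ y) (∘-closed T≤ Tx Ty)
      (trans (cong (y ⟨$⟩ʳ_) xu≡v) yv≡u , trans (cong (y ⟨$⟩ʳ_) xv≡u) yu≡v)
    yx≈id : (y ∘ₚ x) ≈ₚ id
    yx≈id = T∩Fix≡1 (y ∘ₚ x) (∘-closed T≤ Ty Tx)
      (trans (cong (x ⟨$⟩ʳ_) yu≡v) xv≡u , trans (cong (x ⟨$⟩ʳ_) yv≡u) xu≡v)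

aut-maps-arc : ∀ {n} (Γ : Graph n) (g : Perm n) {a a′ b} →
               IsAut Γ g → g ⟨$⟩ʳ a ≡ a′ → Adj Γ a b → Adj Γ a′ (g ⟨$⟩ʳ b)
aut-maps-arc Γ g g-aut ga≡a′ a~b = subst (λ c → Adj Γ c _) ga≡a′ (proj₁ (g-aut _ _) a~b)

conj-∈Stab : ∀ {n} {G : Perm n → Set} → IsSubgroup G → ∀ {g x a b} →
             G g → g ⟨$⟩ʳ a ≡ b → Stab G a x → Stab G b (conj g x)
conj-∈Stab G≤ {g} {x} Gg ga≡b (Gx , xa≡a) = conj-closed G≤ Gg Gx , conj-fixes g x ga≡b xa≡a

LocalKernel : ∀ {n} → Graph n → (Perm n → Set) → Fin n → Perm n → Set
LocalKernel Γ G a x = Stab G a x × (∀ w → Adj Γ a w → Fixes w x)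

LocalKernel-isSubgroup : ∀ {n} {Γ : Graph n} {G : Perm n → Set} →
                         IsSubgroup G → ∀ a → IsSubgroup (LocalKernel Γ G a)
LocalKernel-isSubgroup {Γ = Γ} G≤ a =
  ∩-isSubgroup (∩-isSubgroup G≤ (fixes-isSubgroup a)) (⋂-isSubgroup (Adj Γ a) fixes-isSubgroup)

LocalKernel-conj : ∀ {n} {Γ : Graph n} {G : Perm n → Set} →
  IsSubgroup G → (∀ g → G g → IsAut Γ g) → ∀ {g x a b} →
  G g → g ⟨$⟩ʳ a ≡ b → LocalKernel Γ G a x → LocalKernel Γ G b (conj g x)
LocalKernel-conj {Γ = Γ} G≤ aut {g} {x} Gg ga≡b (x∈G_a , x-fixes-Γ[a]) =
  conj-∈Stab G≤ Gg ga≡b x∈G_a ,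
  λ w b~w → conj-fixes g x (inverseʳ g)
    (x-fixes-Γ[a] _ (aut-maps-arc Γ (flip g) (aut _ (inv-closed G≤ Gg)) (⟨$⟩ʳ⇒⟨$⟩ˡ g ga≡b) b~w))

fixes-everywhere : ∀ {n} {Γ : Graph n} {G T : Perm n → Set} {v : Fin n} →
  IsSubgroup G → IsSubgroup T → (∀ g → G g → IsAut Γ g) → Connected Γ → T ⊆ Fixes v →
  (∀ y → Adj Γ v y → ∃ λ g → G g × g ⟨$⟩ʳ y ≡ v × T ⊆ (T ∘ conj g)) →
  ∀ t → T t → t ≈ₚ id
fixes-everywhere {n} {Γ} {G} {T} {v} G≤ T≤ aut connected T⊆Fixes-v step t Tt w =
  carried⇒fixed (along (connected v w) carried-v)
  where
  Carried : Fin n → Set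
  Carried a = ∃ λ h → G h × h ⟨$⟩ʳ a ≡ v × T ⊆ (T ∘ conj h)

  carried-v : Carried v
  carried-v = id , has-id G≤ , refl , λ _ Tt → resp T≤ (λ _ → refl) Tt

  along : ∀ {a b} → Walk Γ a b → Carried a → Carried b
  along []            carried = carried
  along (a~w ∷ walk) (h , Gh , ha≡v , T⊆T∘conj-h) =
    let (g , Gg , g[hw]≡v , T⊆T∘conj-g) = step _ (aut-maps-arc Γ h (aut h Gh) ha≡v a~w)
    in along walk ( h ∘ₚ g , ∘-closed G≤ Gh Gg , g[hw]≡v
                  , λ t Tt → resp T≤ (λ _ → refl) (T⊆T∘conj-g _ (T⊆T∘conj-h t Tt)))

  carried⇒fixed : Carried w → Fixes w t
  carried⇒fixed (h , _ , hw≡v , T⊆T∘conj-h) =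
    conj-fixes⁻¹ h t hw≡v (T⊆Fixes-v _ (T⊆T∘conj-h t Tt))

module Socle {n} {H T : Perm n → Set} (T≤ : IsSubgroup T) (T◁H : Normal T H)
  (T-simple : NonabelianSimple T)
  (C[T]≡1 : ∀ h → H h → (∀ t → T t → (h ∘ₚ t) ≈ₚ (t ∘ₚ h)) → h ≈ₚ id) where

  T-nontrivial : ¬ (∀ x → T x → x ≈ₚ id)
  T-nontrivial = nonabelianSimple⇒nontrivial T-simple

  ⁅⁆∈T : ∀ {z t} → H z → T t → T ⁅ z , t ⁆
  ⁅⁆∈T {z} {t} Hz Tt = ∘-closed T≤ (inv-closed T≤ Tt) (T◁H z t Hz Tt)

  commutators-trivial⇒≈id : ∀ {z} → H z → (∀ t → T t → ⁅ z , t ⁆ ≈ₚ id) → z ≈ₚ id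
  commutators-trivial⇒≈id {z} Hz ⁅z,T⁆≡1 =
    C[T]≡1 z Hz (λ t Tt → ⁅⁆≈id⇒commute z t (⁅z,T⁆≡1 t Tt))

  T⊆normalisedSubgroup : ∀ {K k} → IsSubgroup K → Normal K T → K k → H k → ¬ k ≈ₚ id → T ⊆ K
  T⊆normalisedSubgroup {K} {k} K≤ K◁T Kk Hk k≉id = meet-nontrivial⇒⊆ T≤ T-simple K≤ K◁T
    (λ T∩K≡1 → k≉id (commutators-trivial⇒≈id Hk (λ t Tt → T∩K≡1 _ (⁅⁆∈T Hk Tt) (⁅k,t⁆∈K Tt))))
    where
    ⁅k,t⁆∈K : ∀ {t} → T t → K ⁅ k , t ⁆
    ⁅k,t⁆∈K {t} Tt = resp K≤ (λ _ → refl) (∘-closed K≤ (K◁T t (flip k) Tt (inv-closed K≤ Kk)) Kk)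

  T⊆LocalKernel : ∀ {Γ : Graph n} {G a k} → IsSubgroup G → (∀ g → G g → IsAut Γ g) →
    T ⊆ Stab G a → LocalKernel Γ G a k → H k → ¬ k ≈ₚ id → T ⊆ LocalKernel Γ G a
  T⊆LocalKernel {Γ} {a = a} G≤ aut T⊆G_a k∈K Hk k≉id =
    T⊆normalisedSubgroup (LocalKernel-isSubgroup {Γ = Γ} G≤ a)
      (λ t x Tt → let (Gt , ta≡a) = T⊆G_a t Tt in LocalKernel-conj {Γ = Γ} G≤ aut {t} {x} Gt ta≡a)
      k∈K Hk k≉id

  conj-preserves-T : ∀ {g} → T ⊆ (H ∘ conj g) → T ⊆ (H ∘ conj (flip g)) → T ⊆ (T ∘ conj g)
  conj-preserves-T {g} T⊆H∘conj-g T⊆H∘conj-g⁻¹ =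
    meet-nontrivial⇒⊆ T≤ T-simple (conjugate-isSubgroup g T≤) T∘conj-g◁T
      (λ T∩T∘conj-g≡1 → T-nontrivial (λ x Tx →
         conj≈id⇒≈id (flip g) x (commutators-trivial⇒≈id (T⊆H∘conj-g⁻¹ x Tx) (λ t Tt →
           T∩T∘conj-g≡1 _ (⁅⁆∈T (T⊆H∘conj-g⁻¹ x Tx) Tt) (conj-⁅⁆∈T Tx Tt)))))
    where
    T∘conj-g◁T : Normal (T ∘ conj g) T
    T∘conj-g◁T t x Tt Tx =
      resp T≤ (conj-conj g t x) (T◁H (conj g t) (conj g x) (T⊆H∘conj-g t Tt) Tx)

    -- Conjugating ⁅ g⁻¹ x g , t ⁆ by g gives x · (g t g⁻¹) · x⁻¹ · (g t g⁻¹)⁻¹.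
    conj-⁅⁆∈T : ∀ {x t} → T x → T t → T (conj g ⁅ conj (flip g) x , t ⁆)
    conj-⁅⁆∈T {x} {t} Tx Tt = resp T≤ (λ _ → ≡.sym (inverseʳ g))
      (∘-closed T≤ (T◁H (conj g t) (flip x) (T⊆H∘conj-g t Tt) (inv-closed T≤ Tx)) Tx)

  ¬arc-conjugators : ∀ {Γ : Graph n} {G v} → IsSubgroup G → (∀ g → G g → IsAut Γ g) →
    Connected Γ → T ⊆ Fixes v →
    ¬ (∀ y → Adj Γ v y → ∃ λ g → G g × g ⟨$⟩ʳ y ≡ v × T ⊆ (H ∘ conj g) × T ⊆ (H ∘ conj (flip g)))
  ¬arc-conjugators {Γ} G≤ aut connected T⊆Fixes-v arc-conjugators =
    T-nontrivial (fixes-everywhere {Γ = Γ} G≤ T≤ aut connected T⊆Fixes-v (λ y v~y →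
      let (g , Gg , gy≡v , T⊆H∘conj-g , T⊆H∘conj-g⁻¹) = arc-conjugators y v~y
      in g , Gg , gy≡v , conj-preserves-T {g} T⊆H∘conj-g T⊆H∘conj-g⁻¹))

module _ {n} {Γ : Graph n} {G : Perm n → Set} (G≤ : IsSubgroup G)
         (aut : ∀ g → G g → IsAut Γ g) (connected : Connected Γ)
         (arc-transitive : ArcTransitive Γ G) {u v : Fin n} (u~v : Adj Γ u v)
         {k : Perm n} (k∈K[v] : LocalKernel Γ G v k) (k≉id : ¬ k ≈ₚ id) where

  private
    v~u : Adj Γ v u
    v~u = Graph.sym Γ u~v

    fixes-ends⇒∈G_e : ∀ {x} → G x → Fixes u x → Fixes v x → EdgeStab G u v x
    fixes-ends⇒∈G_e Gx xu≡u xv≡v = Gx , inj₁ (xu≡u , xv≡v)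

  vertexStab-¬almostSimple : ¬ AlmostSimple (Stab G v)
  vertexStab-¬almostSimple (T , T≤ , T⊆G_v , T◁G_v , T-simple , C[T]≡1) =
    ¬arc-conjugators G≤ aut connected (λ t Tt → proj₂ (T⊆G_v t Tt)) arc-conjugator
    where
    open Socle T≤ T◁G_v T-simple C[T]≡1

    T⊆K[v] : T ⊆ LocalKernel Γ G v
    T⊆K[v] = T⊆LocalKernel {Γ = Γ} G≤ aut T⊆G_v k∈K[v] (proj₁ k∈K[v]) k≉id

    arc-conjugator : ∀ y → Adj Γ v y → ∃ λ g → G g × g ⟨$⟩ʳ y ≡ v ×
                     T ⊆ (Stab G v ∘ conj g) × T ⊆ (Stab G v ∘ conj (flip g))
    arc-conjugator y v~y =
      let (g , Gg , gv≡u , gy≡v) = arc-transitive v y u v v~y u~v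
      in g , Gg , gy≡v
       , (λ t Tt → let ((Gt , _) , t-fixes-Γ[v]) = T⊆K[v] t Tt
                   in conj-∈Stab G≤ Gg gy≡v (Gt , t-fixes-Γ[v] y v~y))
       , (λ t Tt → let ((Gt , _) , t-fixes-Γ[v]) = T⊆K[v] t Tt
                   in conj-∈Stab G≤ (inv-closed G≤ Gg) (⟨$⟩ʳ⇒⟨$⟩ˡ g gv≡u) (Gt , t-fixes-Γ[v] u v~u))

  edgeStab-¬almostSimple : ¬ AlmostSimple (EdgeStab G u v)
  edgeStab-¬almostSimple (T , T≤ , T⊆G_e , T◁G_e , T-simple , C[T]≡1) =
    ¬arc-conjugators G≤ aut connected (λ t Tt → proj₂ (T⊆G_v t Tt)) arc-conjugator
    where
    open Socle T≤ T◁G_e T-simple C[T]≡1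

    T-fixes-ends : T ⊆ (λ x → Fixes u x × Fixes v x)
    T-fixes-ends = stabilises-edge⇒fixes-ends T≤ T-simple (λ t Tt → proj₂ (T⊆G_e t Tt))

    T⊆G_u : T ⊆ Stab G u
    T⊆G_u t Tt = proj₁ (T⊆G_e t Tt) , proj₁ (T-fixes-ends t Tt)

    T⊆G_v : T ⊆ Stab G v
    T⊆G_v t Tt = proj₁ (T⊆G_e t Tt) , proj₂ (T-fixes-ends t Tt)

    T⊆K[v] : T ⊆ LocalKernel Γ G v
    T⊆K[v] = let ((Gk , kv≡v) , k-fixes-Γ[v]) = k∈K[v]
             in T⊆LocalKernel {Γ = Γ} G≤ aut T⊆G_v k∈K[v]
                  (fixes-ends⇒∈G_e Gk (k-fixes-Γ[v] u v~u) kv≡v) k≉id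

    T⊆K[u] : T ⊆ LocalKernel Γ G u
    T⊆K[u] = let (s , Gs , sv≡u , _) = arc-transitive v u u v v~u u~v
                 k′∈K[u] = LocalKernel-conj {Γ = Γ} G≤ aut {s} {k} Gs sv≡u k∈K[v]
                 ((Gk′ , k′u≡u) , k′-fixes-Γ[u]) = k′∈K[u]
             in T⊆LocalKernel {Γ = Γ} G≤ aut T⊆G_u k′∈K[u]
                  (fixes-ends⇒∈G_e Gk′ k′u≡u (k′-fixes-Γ[u] v u~v)) (k≉id ∘ conj≈id⇒≈id s k)

    arc-conjugator : ∀ y → Adj Γ v y → ∃ λ g → G g × g ⟨$⟩ʳ y ≡ v ×
                     T ⊆ (EdgeStab G u v ∘ conj g) × T ⊆ (EdgeStab G u v ∘ conj (flip g))
    arc-conjugator y v~y =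
      let (g , Gg , gv≡u , gy≡v) = arc-transitive v y u v v~y u~v
          u~gu = aut-maps-arc Γ g (aut g Gg) gv≡u v~u
      in g , Gg , gy≡v
       , (λ t Tt → let ((Gt , tv≡v) , t-fixes-Γ[v]) = T⊆K[v] t Tt
                   in fixes-ends⇒∈G_e (conj-closed G≤ Gg Gt)
                        (conj-fixes g t gv≡u tv≡v) (conj-fixes g t gy≡v (t-fixes-Γ[v] y v~y)))
       , (λ t Tt → let ((Gt , tu≡u) , t-fixes-Γ[u]) = T⊆K[u] t Tt
                   in fixes-ends⇒∈G_e (conj-closed G≤ (inv-closed G≤ Gg) Gt)
                        (conj-fixes (flip g) t (inverseˡ g) (t-fixes-Γ[u] _ u~gu))
                        (conj-fixes (flip g) t (⟨$⟩ʳ⇒⟨$⟩ˡ g gv≡u) tu≡u))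

lemma1p6 : ∀ {n} (Γ : Graph n) (G : Perm n → Set) →
    IsSubgroup G → (∀ g → G g → IsAut Γ g) →
    Connected Γ → Nontrivial Γ G → EdgePrimitive Γ G →
    (u v : Fin n) → Adj Γ u v →
    UnfaithfulOnNbhd Γ G v →
    ¬ AlmostSimple (Stab G v) × ¬ AlmostSimple (EdgeStab G u v)
lemma1p6 Γ G G≤ aut connected (arc-transitive , _) _ u v u~v (k , k∈G_v , k-fixes-Γ[v] , k≉id) =
  vertexStab-¬almostSimple G≤ aut connected arc-transitive u~v k∈K[v] k≉id ,
  edgeStab-¬almostSimple G≤ aut connected arc-transitive u~v k∈K[v] k≉id
  where
  k∈K[v] : LocalKernel Γ G v k
  k∈K[v] = k∈G_v , k-fixes-Γ[v]
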